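{- For every integer $n\geq 4$ there is a tree $B_n$ with $\beta(B_n)=2$ and $$n=\psi(B_n)\leq \beta(B_n\,\square\,B_n)\leq n+1.$$
   Context: $d(v,w)$ denotes shortest-path distance. A vertex $x$ resolves $v,w$ if $d(v,x)\neq d(w,x)$; a set resolves a graph if every pair of distinct vertices is resolved by some vertex of the set; $\beta(G)$ is the minimum size of a resolving set. For $G\neq K_1$, vertices $v,w$ are doubly resolved by $x,y$ if $d(v,x)-d(w,x)\neq d(v,y)-d(w,y)$; a set is doubly resolving if every pair of distinct vertices is doubly resolved by two vertices of the set; $\psi(G)$ is the minimum size of a doubly resolving set. The cartesian product $G\,\square\,H$ has vertex set $V(G)\times V(H)$, with $(a,v)\sim(b,w)$ iff ($a=b$ and $vw\in E(H)$) or ($v=w$ and $ab\in E(G)$). -}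

module Defs where

open import Data.Nat using (ℕ; zero; suc; _≤_)
open import Data.Integer using (ℤ; +_; _-_)
open import Data.Fin using (Fin; zero; suc; inject₁; fromℕ)
open import Data.Product using (Σ; ∃; _×_; _,_)
open import Data.Sum using (_⊎_; inj₁; inj₂)
open import Data.Empty using (⊥)
open import Data.List using (List; length)
open import Data.List.Membership.Propositional using (_∈_)
open import Data.List.Relation.Unary.Unique.Propositional using (Unique)
open import Relation.Nullary using (¬_)
open import Relation.Binary.PropositionalEquality using (_≡_; _≢_; refl)
open import Function.Definitions using (Injective)

record Graph (V : Set) : Set₁ where
  field
    _~_    : V → V → Set
    ~-sym  : ∀ {u v} → u ~ v → v ~ u
    ~-irr  : ∀ {v} → ¬ (v ~ v)
open Graph public

data Walk {V : Set} (G : Graph V) : V → V → ℕ → Set where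
  here : ∀ {v} → Walk G v v 0
  step : ∀ {u v w k} → _~_ G u v → Walk G v w k → Walk G u w (suc k)

Dist : {V : Set} → Graph V → V → V → ℕ → Set
Dist G u v k = Walk G u v k × (∀ j → Walk G u v j → k ≤ j)

Connected : {V : Set} → Graph V → Set
Connected G = ∀ u v → ∃ λ k → Walk G u v k

HasCycle : {V : Set} → Graph V → Set
HasCycle {V} G = Σ ℕ λ m → Σ (Fin (suc (suc (suc m))) → V) λ f →
  Injective _≡_ _≡_ f ×
  (∀ (i : Fin (suc (suc m))) → _~_ G (f (inject₁ i)) (f (suc i))) ×
  _~_ G (f (fromℕ (suc (suc m)))) (f zero)

IsTree : {N : ℕ} → Graph (Fin N) → Set
IsTree {N} G = (1 ≤ N) × Connected G × ¬ HasCycle G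

Resolves : {V : Set} → Graph V → V → V → V → Set
Resolves G x v w = Σ ℕ λ a → Σ ℕ λ b → Dist G v x a × Dist G w x b × a ≢ b

Resolving : {V : Set} → Graph V → List V → Set
Resolving G S = ∀ v w → v ≢ w → Σ _ λ x → x ∈ S × Resolves G x v w

MetricDim : {V : Set} → Graph V → ℕ → Set
MetricDim G m =
  (Σ _ λ S → Unique S × Resolving G S × length S ≡ m) ×
  (∀ S → Unique S → Resolving G S → m ≤ length S)

DoublyResolves : {V : Set} → Graph V → V → V → V → V → Set
DoublyResolves G x y v w = Σ ℕ λ a → Σ ℕ λ b → Σ ℕ λ c → Σ ℕ λ e →
  Dist G v x a × Dist G w x b × Dist G v y c × Dist G w y e ×
  ((+ a) - (+ b) ≢ (+ c) - (+ e))

DoublyResolving : {V : Set} → Graph V → List V → Set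
DoublyResolving G S = ∀ v w → v ≢ w →
  Σ _ λ x → Σ _ λ y → x ∈ S × y ∈ S × DoublyResolves G x y v w

DoublyMetricDim : {V : Set} → Graph V → ℕ → Set
DoublyMetricDim G m =
  (Σ _ λ S → Unique S × DoublyResolving G S × length S ≡ m) ×
  (∀ S → Unique S → DoublyResolving G S → m ≤ length S)

□-adj : {A B : Set} → Graph A → Graph B → A × B → A × B → Set
□-adj G H (a , v) (b , w) = (a ≡ b × _~_ H v w) ⊎ (v ≡ w × _~_ G a b)

_□_ : {A B : Set} → Graph A → Graph B → Graph (A × B)
_□_ G H = record
  { _~_ = □-adj G H
  ; ~-sym = λ { (inj₁ (refl , p)) → inj₁ (refl , ~-sym H p)
              ; (inj₂ (refl , p)) → inj₂ (refl , ~-sym G p) }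
  ; ~-irr = λ { (inj₁ (_ , p)) → ~-irr H p
              ; (inj₂ (_ , p)) → ~-irr G p } }

-- B_n is the comb: a spine path X₀ … X_L (L = n - 1) with a pendant tooth Tᵢ attached to each Xᵢ.
-- Its distance function is explicit, and every claim becomes arithmetic on it once we know
-- that a function realised by walks and 1-Lipschitz along edges is the graph distance.
-- The two ends of the spine resolve B_n and no single vertex does, so β(B_n) = 2.
-- A tooth t at x satisfies d(t,z) = d(x,z) + 1 for every z ≠ t, so the pair t, x is doubly
-- resolved only by sets containing t, and in G □ G the pair (t, x′), (x, t′) is resolved only
-- by a vertex in the row of t or the column of t′; with n teeth this gives ψ(B_n) ≥ n and
-- β(B_n □ B_n) ≥ n. The teeth doubly resolve B_n, and the n vertices (Tₖ, Yₖ), with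
-- Yₖ = X_L for k ∈ {0, L} and Yₖ = X₀ otherwise, resolve B_n □ B_n when n ≥ 4,
-- so in fact β(B_n □ B_n) = n.
module Submission where

open import Defs
open import Data.Bool using (if_then_else_; _∨_)
open import Data.Empty using (⊥; ⊥-elim)
open import Data.Fin using (Fin; zero; suc; toℕ; fromℕ; fromℕ<; inject₁; _≟_)
open import Data.Fin.Properties
  using (toℕ-injective; toℕ-fromℕ; toℕ-fromℕ<; toℕ<n; toℕ≤pred[n]; toℕ-inject₁; injective⇒≤; ¬∀⟶∃¬; +↔⊎)
  renaming (all? to allFin?)
open import Data.Fin.Relation.Unary.Top using (view; ‵fromℕ; ‵inject₁)
open import Data.Integer as ℤ using (ℤ)
import Data.Integer.Properties as ℤ
open import Data.Integer.Tactic.RingSolver using (solve-∀)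
open import Data.List using (List; []; _∷_; length; lookup; map; tabulate; allFin)
open import Data.List.Extrema.Nat using (argmax; f[xs]≤f[argmax])
open import Data.List.Membership.Propositional using (_∈_; _∉_; find; lose)
open import Data.List.Membership.Propositional.Properties using (∈-map⁺; ∈-tabulate⁺; ∈-allFin)
import Data.List.Membership.DecPropositional as DecMembership
open import Data.List.Properties using (length-map; length-tabulate)
open import Data.List.Relation.Unary.All as All using ([]; _∷_)
open import Data.List.Relation.Unary.AllPairs using ([]; _∷_)
open import Data.List.Relation.Unary.Any as Any using (here; there; any?)
open import Data.List.Relation.Unary.Any.Properties using (lookup-index)
open import Data.List.Relation.Unary.Unique.Propositional.Properties
  using (tabulate⁺) renaming (map⁺ to unique-map⁺)
open import Data.Nat using (ℕ; zero; suc; _+_; _∸_; _≤_; _<_; z≤n; s≤s; z<s; ∣_-_∣; _≤?_)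
open import Data.Nat.Properties
  using (≤-refl; ≤-reflexive; ≤-trans; ≤-<-trans; ≤-antisym; ≤-total; <⇒≤; <⇒≢; ≰⇒>; <-cmp; 1+n≰n;
         n≤1+n; m≤n+m; m<m+n; 0≢1+n; m≢1+n+m; n≢0⇒n>0; suc-injective;
         +-comm; +-suc; +-identityʳ; +-cancelˡ-≡; +-cancelʳ-≡; +-cancelʳ-≤; +-mono-≤; +-monoˡ-≤;
         +-monoʳ-≤; +-mono-<-≤; m∸n≤m; m∸n+n≡m; ∸-monoʳ-≤; ⊔-lub;
         ∣n-n∣≡0; ∣m-n∣≡0⇒m≡n; ∣-∣-comm; ∣-∣-identityʳ; ∣-∣-triangle; ∣m-m+n∣≡n; ∣m-n∣≤m⊔n;
         m≤n⇒∣m-n∣≡n∸m; m≤n⇒∣n-m∣≡n∸m)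
  renaming (_≟_ to _≟ℕ_)
open import Data.Nat.Tactic.RingSolver using () renaming (solve-∀ to ℕ-solve-∀)
open import Data.Product using (Σ; _×_; _,_; proj₁; proj₂)
open import Data.Product.Function.NonDependent.Propositional using (_×-↔_)
open import Data.Sum using (_⊎_; inj₁; inj₂)
open import Data.Sum.Properties using (≡-dec; inj₂-injective)
open import Function using (_∘_; _↔_; Inverse; Injection)
open import Function.Definitions using (Injective)
open import Function.Properties.Inverse using (↔-sym; ↔⇒↣)
open import Relation.Binary.Definitions using (DecidableEquality; tri<; tri≈; tri>)
open import Relation.Binary.PropositionalEquality
open import Relation.Nullary using (¬_; ¬?; does; yes; no)
open import Relation.Nullary.Decidable using (decidable-stable; dec-true; dec-false)

open ≡-Reasoning

+m-+n≡+o-+p⇒m+p≡o+n : ∀ m n o p → ℤ.+_ m ℤ.- ℤ.+_ n ≡ ℤ.+_ o ℤ.- ℤ.+_ p → m + p ≡ o + n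
+m-+n≡+o-+p⇒m+p≡o+n m n o p eq = ℤ.+-injective (begin
  ℤ.+_ (m + p)                                 ≡⟨ ℤ.pos-+ m p ⟩
  ℤ.+_ m ℤ.+ ℤ.+_ p                            ≡⟨ add-diff (ℤ.+_ m) (ℤ.+_ n) (ℤ.+_ p) ⟩
  (ℤ.+_ m ℤ.- ℤ.+_ n) ℤ.+ (ℤ.+_ n ℤ.+ ℤ.+_ p)  ≡⟨ cong (ℤ._+ (ℤ.+_ n ℤ.+ ℤ.+_ p)) eq ⟩
  (ℤ.+_ o ℤ.- ℤ.+_ p) ℤ.+ (ℤ.+_ n ℤ.+ ℤ.+_ p)  ≡⟨ diff-add (ℤ.+_ o) (ℤ.+_ n) (ℤ.+_ p) ⟩
  ℤ.+_ o ℤ.+ ℤ.+_ n                            ≡⟨ ℤ.pos-+ o n ⟨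
  ℤ.+_ (o + n)                                 ∎)
  where
    add-diff : ∀ (a b e : ℤ) → a ℤ.+ e ≡ (a ℤ.- b) ℤ.+ (b ℤ.+ e)
    add-diff = solve-∀
    diff-add : ∀ (c b e : ℤ) → (c ℤ.- e) ℤ.+ (b ℤ.+ e) ≡ c ℤ.+ b
    diff-add = solve-∀

m+p≡o+n⇒+m-+n≡+o-+p : ∀ m n o p → m + p ≡ o + n → ℤ.+_ m ℤ.- ℤ.+_ n ≡ ℤ.+_ o ℤ.- ℤ.+_ p
m+p≡o+n⇒+m-+n≡+o-+p m n o p eq = begin
  ℤ.+_ m ℤ.- ℤ.+_ n                            ≡⟨ shift (ℤ.+_ m) (ℤ.+_ n) (ℤ.+_ p) ⟩
  (ℤ.+_ m ℤ.+ ℤ.+_ p) ℤ.- (ℤ.+_ n ℤ.+ ℤ.+_ p)  ≡⟨ cong (ℤ._- (ℤ.+_ n ℤ.+ ℤ.+_ p)) (begin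
      ℤ.+_ m ℤ.+ ℤ.+_ p  ≡⟨ ℤ.pos-+ m p ⟨
      ℤ.+_ (m + p)       ≡⟨ cong ℤ.+_ eq ⟩
      ℤ.+_ (o + n)       ≡⟨ ℤ.pos-+ o n ⟩
      ℤ.+_ o ℤ.+ ℤ.+_ n  ∎) ⟩
  (ℤ.+_ o ℤ.+ ℤ.+_ n) ℤ.- (ℤ.+_ n ℤ.+ ℤ.+_ p)  ≡⟨ unshift (ℤ.+_ o) (ℤ.+_ n) (ℤ.+_ p) ⟩
  ℤ.+_ o ℤ.- ℤ.+_ p                            ∎
  where
    shift : ∀ (a b e : ℤ) → a ℤ.- b ≡ (a ℤ.+ e) ℤ.- (b ℤ.+ e)
    shift = solve-∀
    unshift : ∀ (c b e : ℤ) → (c ℤ.+ b) ℤ.- (b ℤ.+ e) ≡ c ℤ.- e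
    unshift = solve-∀

∣n-1+n∣≡1 : ∀ n → ∣ n - suc n ∣ ≡ 1
∣n-1+n∣≡1 n = trans (cong (∣ n -_∣) (+-comm 1 n)) (∣m-m+n∣≡n n 1)

m+[o∸n]≡n+[o∸m]⇒m≡n : ∀ o {m n} → m + (o ∸ n) ≡ n + (o ∸ m) → m ≡ n
m+[o∸n]≡n+[o∸m]⇒m≡n o {m} {n} eq with <-cmp m n
... | tri< m<n _ _ = ⊥-elim (<⇒≢ (+-mono-<-≤ m<n (∸-monoʳ-≤ o (<⇒≤ m<n))) eq)
... | tri≈ _ m≡n _ = m≡n
... | tri> _ _ n<m = ⊥-elim (<⇒≢ (+-mono-<-≤ n<m (∸-monoʳ-≤ o (<⇒≤ n<m))) (sym eq))

m≤n⇒m≢n+1+o : ∀ {m n o} → m ≤ n → m ≢ n + suc o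
m≤n⇒m≢n+1+o {n = n} m≤n = <⇒≢ (≤-<-trans m≤n (m<m+n n z<s))

argmax-Fin : ∀ {n} (f : Fin (suc n) → ℕ) → Σ (Fin (suc n)) λ i → ∀ j → f j ≤ f i
argmax-Fin f = argmax f zero (allFin _) ,
  λ j → All.lookup (f[xs]≤f[argmax] {f = f} zero (allFin _)) (∈-allFin j)

injective⇒≤-length : {A : Set} {n : ℕ} {xs : List A} (f : Fin n → A) →
                     Injective _≡_ _≡_ f → (∀ k → f k ∈ xs) → n ≤ length xs
injective⇒≤-length {xs = xs} f f-injective f∈xs = injective⇒≤ {f = Any.index ∘ f∈xs} λ {k} {l} eq →
  f-injective (trans (lookup-index (f∈xs k)) (trans (cong (lookup xs) eq) (sym (lookup-index (f∈xs l)))))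

module _ {V : Set} {G : Graph V} where

  infixl 5 _∷ʳ_
  infixr 5 _++ʷ_

  _∷ʳ_ : ∀ {u v w k} → Walk G u v k → _~_ G v w → Walk G u w (suc k)
  here     ∷ʳ e′ = step e′ here
  step e p ∷ʳ e′ = step e (p ∷ʳ e′)

  reverseʷ : ∀ {u v k} → Walk G u v k → Walk G v u k
  reverseʷ here       = here
  reverseʷ (step e p) = reverseʷ p ∷ʳ ~-sym G e

  _++ʷ_ : ∀ {u v w k l} → Walk G u v k → Walk G v w l → Walk G u w (k + l)
  here     ++ʷ q = q
  step e p ++ʷ q = step e (p ++ʷ q)

module _ {V : Set} (G : Graph V) where

  cycle-neighbours : ∀ {m} (c : Fin (suc (suc (suc m))) → V) →
    (∀ i → _~_ G (c (inject₁ i)) (c (suc i))) → _~_ G (c (fromℕ (suc (suc m)))) (c zero) →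
    ∀ i → Σ _ λ a → Σ _ λ b → a ≢ b × _~_ G (c i) (c a) × _~_ G (c i) (c b)
  cycle-neighbours _ edges closing zero =
    suc zero , fromℕ _ , (λ ()) , edges zero , ~-sym G closing
  cycle-neighbours c edges closing (suc i) with view i
  ... | ‵fromℕ     = inject₁ i , zero , (λ ()) , ~-sym G (edges i) , closing
  ... | ‵inject₁ j = inject₁ i , suc (suc j) , inject₁≢suc , ~-sym G (edges i) , edges (suc j)
    where
      inject₁≢suc : inject₁ (inject₁ j) ≢ suc (suc j)
      inject₁≢suc eq = m≢1+n+m (toℕ j) {1}
        (trans (sym (trans (toℕ-inject₁ (inject₁ j)) (toℕ-inject₁ j))) (cong toℕ eq))

  uniqueLowerNeighbour⇒acyclic : (h : V → ℕ) →
    (∀ {u v w} → _~_ G u v → _~_ G u w → h v ≤ h u → h w ≤ h u → v ≡ w) →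
    ¬ HasCycle G
  uniqueLowerNeighbour⇒acyclic h unique (m , c , c-injective , edges , closing) =
    at-highest (argmax-Fin (h ∘ c))
    where
      at-highest : (Σ _ λ top → ∀ j → h (c j) ≤ h (c top)) → ⊥
      at-highest (top , below) with cycle-neighbours c edges closing top
      ... | a , b , a≢b , ~a , ~b = a≢b (c-injective (unique ~a ~b (below a) (below b)))

comap : {V W : Set} → (V → W) → Graph W → Graph V
comap f G = record { _~_ = λ u v → _~_ G (f u) (f v) ; ~-sym = ~-sym G ; ~-irr = ~-irr G }

comap-acyclic : {V W : Set} {G : Graph W} (f : V → W) → Injective _≡_ _≡_ f →
                ¬ HasCycle G → ¬ HasCycle (comap f G)
comap-acyclic f f-injective acyclic (m , c , c-injective , edges , closing) =
  acyclic (m , f ∘ c , c-injective ∘ f-injective , edges , closing)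

-- DoublyResolves compares d(v,x) - d(w,x) with d(v,y) - d(w,y) in ℤ; moving the subtracted
-- terms across turns this into an inequation in ℕ.
DoublyResolvesᵈ : {V : Set} → (V → V → ℕ) → V → V → V → V → Set
DoublyResolvesᵈ d x y v w = d v x + d w y ≢ d v y + d w x

doublyResolvesᵈ-swap : ∀ {V : Set} {d : V → V → ℕ} {x y v w} →
                       DoublyResolvesᵈ d x y v w → DoublyResolvesᵈ d x y w v
doublyResolvesᵈ-swap {d = d} {x} {y} {v} {w} resolves eq =
  resolves (trans (+-comm (d v x) (d w y)) (trans (sym eq) (+-comm (d w x) (d v y))))

Resolvingᵈ : {V : Set} → (V → V → ℕ) → List V → Set
Resolvingᵈ d S = ∀ v w → (∀ x → x ∈ S → d v x ≡ d w x) → v ≡ w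

DoublyResolvingᵈ : {V : Set} → (V → V → ℕ) → List V → Set
DoublyResolvingᵈ {V} d S =
  ∀ v w → v ≢ w → Σ V λ x → Σ V λ y → x ∈ S × y ∈ S × DoublyResolvesᵈ d x y v w

Pendant : {V : Set} → (V → V → ℕ) → V → V → Set
Pendant d t x = t ≢ x × (∀ z → z ≢ t → d t z ≡ suc (d x z))

record IsDistance {V : Set} (G : Graph V) (d : V → V → ℕ) : Set where
  field
    walk      : ∀ u v → Walk G u v (d u v)
    diagonal  : ∀ v → d v v ≡ 0
    lipschitz : ∀ {u u′} v → _~_ G u u′ → d u v ≤ suc (d u′ v)

  ≤-length : ∀ {u v k} → Walk G u v k → d u v ≤ k
  ≤-length {v = v} here       = ≤-reflexive (diagonal v)
  ≤-length {v = v} (step e p) = ≤-trans (lipschitz v e) (s≤s (≤-length p))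

  dist : ∀ u v → Dist G u v (d u v)
  dist u v = walk u v , λ _ → ≤-length

  dist-unique : ∀ {u v k} → Dist G u v k → k ≡ d u v
  dist-unique (p , shortest) = ≤-antisym (shortest _ (walk _ _)) (≤-length p)

  connected : Connected G
  connected u v = d u v , walk u v

  resolves⇒≢ : ∀ {x v w} → Resolves G x v w → d v x ≢ d w x
  resolves⇒≢ (_ , _ , dv , dw , a≢b) eq = a≢b (trans (dist-unique dv) (trans eq (sym (dist-unique dw))))

  ≢⇒resolves : ∀ {x v w} → d v x ≢ d w x → Resolves G x v w
  ≢⇒resolves {x} {v} {w} ≢ = _ , _ , dist v x , dist w x , ≢

  doublyResolves⇒doublyResolvesᵈ : ∀ {x y v w} → DoublyResolves G x y v w → DoublyResolvesᵈ d x y v w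
  doublyResolves⇒doublyResolvesᵈ {x} {y} {v} {w} (_ , _ , _ , _ , dvx , dwx , dvy , dwy , ≢) eq
    rewrite dist-unique dvx | dist-unique dwx | dist-unique dvy | dist-unique dwy =
    ≢ (m+p≡o+n⇒+m-+n≡+o-+p (d v x) (d w x) (d v y) (d w y) eq)

  doublyResolvesᵈ⇒doublyResolves : ∀ {x y v w} → DoublyResolvesᵈ d x y v w → DoublyResolves G x y v w
  doublyResolvesᵈ⇒doublyResolves {x} {y} {v} {w} ≢ =
    _ , _ , _ , _ , dist v x , dist w x , dist v y , dist w y ,
    λ eq → ≢ (+m-+n≡+o-+p⇒m+p≡o+n (d v x) (d w x) (d v y) (d w y) eq)

  resolvingᵈ⇒resolving : ∀ {S} → Resolvingᵈ d S → Resolving G S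
  resolvingᵈ⇒resolving {S} separates v w v≢w with any? (λ x → ¬? (d v x ≟ℕ d w x)) S
  ... | yes found = let x , x∈S , ≢ = find found in x , x∈S , ≢⇒resolves ≢
  ... | no none   = ⊥-elim (v≢w (separates v w λ x x∈S →
                      decidable-stable (d v x ≟ℕ d w x) (λ ≢ → none (lose x∈S ≢))))

  doublyResolvingᵈ⇒doublyResolving : ∀ {S} → DoublyResolvingᵈ d S → DoublyResolving G S
  doublyResolvingᵈ⇒doublyResolving separates v w v≢w =
    let x , y , x∈S , y∈S , ≢ = separates v w v≢w
    in x , y , x∈S , y∈S , doublyResolvesᵈ⇒doublyResolves ≢

  noResolvingVertex⇒2≤length : V → (∀ x → Σ V λ v → Σ V λ w → v ≢ w × d v x ≡ d w x) →
                               ∀ {S} → Resolving G S → 2 ≤ length S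
  noResolvingVertex⇒2≤length v₀ equidistant {[]} resolving
    with v , w , v≢w , _ ← equidistant v₀
    with _ , () , _ ← resolving v w v≢w
  noResolvingVertex⇒2≤length _ equidistant {x ∷ []} resolving
    with v , w , v≢w , eq ← equidistant x
    with _ , here refl , resolves ← resolving v w v≢w
    = ⊥-elim (resolves⇒≢ resolves eq)
  noResolvingVertex⇒2≤length _ _ {_ ∷ _ ∷ _} _ = s≤s (s≤s z≤n)

  module _ (_≟ᵥ_ : DecidableEquality V) where

    pendant∈doublyResolving : ∀ {t x S} → Pendant d t x → DoublyResolving G S → t ∈ S
    pendant∈doublyResolving {t} {x} (t≢x , hangs) resolving
      with y , z , y∈S , z∈S , resolves ← resolving t x t≢x
      with y ≟ᵥ t | z ≟ᵥ t
    ... | yes refl | _        = y∈S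
    ... | no _     | yes refl = z∈S
    ... | no y≢t   | no z≢t   = ⊥-elim (doublyResolves⇒doublyResolvesᵈ resolves (begin
      d t y + d x z        ≡⟨ cong (_+ d x z) (hangs y y≢t) ⟩
      suc (d x y + d x z)  ≡⟨ cong suc (+-comm (d x y) (d x z)) ⟩
      suc (d x z + d x y)  ≡⟨ cong (_+ d x y) (hangs z z≢t) ⟨
      d t z + d x y        ∎))

    pendants≤doublyResolving : ∀ {n S} (t x : Fin n → V) → Injective _≡_ _≡_ t →
      (∀ k → Pendant d (t k) (x k)) → DoublyResolving G S → n ≤ length S
    pendants≤doublyResolving t _ t-injective pendant resolving =
      injective⇒≤-length t t-injective (λ k → pendant∈doublyResolving (pendant k) resolving)

_⊞_ : {A B : Set} → (A → A → ℕ) → (B → B → ℕ) → (A × B → A × B → ℕ)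
(d ⊞ e) u v = d (proj₁ u) (proj₁ v) + e (proj₂ u) (proj₂ v)

⊞-equidistant-cancel : ∀ {V W : Set} {d : V → V → ℕ} {e : W → W → ℕ} {p q : V × W} {t t′ y} →
  (d ⊞ e) p (t , y) ≡ (d ⊞ e) q (t , y) → (d ⊞ e) p (t′ , y) ≡ (d ⊞ e) q (t′ , y) →
  d (proj₁ p) t + d (proj₁ q) t′ ≡ d (proj₁ p) t′ + d (proj₁ q) t
⊞-equidistant-cancel {d = d} {e} {p₁ , p₂} {q₁ , q₂} {t} {t′} {y} eq eq′ =
  +-cancelʳ-≡ (e p₂ y + e q₂ y) _ _ (begin
    (d p₁ t + d q₁ t′) + (e p₂ y + e q₂ y)  ≡⟨ regroup (d p₁ t) (d q₁ t′) (e p₂ y) (e q₂ y) ⟩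
    (d p₁ t + e p₂ y) + (d q₁ t′ + e q₂ y)  ≡⟨ cong₂ _+_ eq (sym eq′) ⟩
    (d q₁ t + e q₂ y) + (d p₁ t′ + e p₂ y)  ≡⟨ regroup′ (d q₁ t) (e q₂ y) (d p₁ t′) (e p₂ y) ⟩
    (d p₁ t′ + d q₁ t) + (e p₂ y + e q₂ y)  ∎)
  where
    regroup : ∀ a b c c′ → (a + b) + (c + c′) ≡ (a + c) + (b + c′)
    regroup = ℕ-solve-∀
    regroup′ : ∀ a c′ b c → (a + c′) + (b + c) ≡ (b + a) + (c + c′)
    regroup′ = ℕ-solve-∀

module _ {A B : Set} {G : Graph A} {H : Graph B} where

  walkˡ : ∀ {a c k} (b : B) → Walk G a c k → Walk (G □ H) (a , b) (c , b) k
  walkˡ b here       = here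
  walkˡ b (step e p) = step (inj₂ (refl , e)) (walkˡ b p)

  walkʳ : ∀ {b c k} (a : A) → Walk H b c k → Walk (G □ H) (a , b) (a , c) k
  walkʳ a here       = here
  walkʳ a (step e p) = step (inj₁ (refl , e)) (walkʳ a p)

  □-isDistance : ∀ {d e} → IsDistance G d → IsDistance H e → IsDistance (G □ H) (d ⊞ e)
  □-isDistance {d} {e} G-dist H-dist = record
    { walk      = λ (a , b) (c , b′) → walkˡ b (G.walk a c) ++ʷ walkʳ c (H.walk b b′)
    ; diagonal  = λ (a , b) → cong₂ _+_ (G.diagonal a) (H.diagonal b)
    ; lipschitz = lipschitz
    }
    where
      module G = IsDistance G-dist
      module H = IsDistance H-dist
      lipschitz : ∀ {u u′} v → □-adj G H u u′ → (d ⊞ e) u v ≤ suc ((d ⊞ e) u′ v)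
      lipschitz {a , b} {_ , b′} (c , c′) (inj₁ (refl , edge)) =
        ≤-trans (+-monoʳ-≤ (d a c) (H.lipschitz c′ edge)) (≤-reflexive (+-suc (d a c) (e b′ c′)))
      lipschitz {a , b} (c , c′) (inj₂ (refl , edge)) =
        +-monoˡ-≤ (e b c′) (G.lipschitz c edge)

module _ {V W : Set} {G : Graph V} {H : Graph W} {d : V → V → ℕ} {e : W → W → ℕ}
         (G-dist : IsDistance G d) (H-dist : IsDistance H e)
         (_≟ᵥ_ : DecidableEquality V) (_≟ʷ_ : DecidableEquality W) where
  open IsDistance (□-isDistance G-dist H-dist)
  open DecMembership _≟ᵥ_ using (_∈?_)

  □-resolving-meets-row-or-column : ∀ {t x t′ x′ S} → Pendant d t x → Pendant e t′ x′ →
    Resolving (G □ H) S → Σ (V × W) λ z → z ∈ S × (proj₁ z ≡ t ⊎ proj₂ z ≡ t′)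
  □-resolving-meets-row-or-column {t} {x} {t′} {x′} (t≢x , hangs) (_ , hangs′) resolving
    with (z , z′) , z∈S , resolves ← resolving (t , x′) (x , t′) (t≢x ∘ cong proj₁)
    with z ≟ᵥ t | z′ ≟ʷ t′
  ... | yes z≡t | _         = _ , z∈S , inj₁ z≡t
  ... | no _    | yes z′≡t′ = _ , z∈S , inj₂ z′≡t′
  ... | no z≢t  | no z′≢t′  = ⊥-elim (resolves⇒≢ resolves (begin
    d t z + e x′ z′        ≡⟨ cong (_+ e x′ z′) (hangs z z≢t) ⟩
    suc (d x z + e x′ z′)  ≡⟨ +-suc (d x z) (e x′ z′) ⟨
    d x z + suc (e x′ z′)  ≡⟨ cong (d x z +_) (hangs′ z′ z′≢t′) ⟨
    d x z + e t′ z′        ∎))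

  pendants≤□-resolving : ∀ {n S} (t x : Fin n → V) (t′ x′ : Fin n → W) →
    Injective _≡_ _≡_ t → Injective _≡_ _≡_ t′ →
    (∀ k → Pendant d (t k) (x k)) → (∀ k → Pendant e (t′ k) (x′ k)) →
    Resolving (G □ H) S → n ≤ length S
  pendants≤□-resolving {n} {S} t _ t′ _ t-injective t′-injective pendant pendant′ resolving
    with allFin? (λ k → t k ∈? map proj₁ S)
  ... | yes rows = ≤-trans (injective⇒≤-length t t-injective rows) (≤-reflexive (length-map proj₁ S))
  ... | no ¬rows =
    let k , k∉ = ¬∀⟶∃¬ n _ (λ k → t k ∈? map proj₁ S) ¬rows
    in ≤-trans (injective⇒≤-length t′ t′-injective (columns k∉)) (≤-reflexive (length-map proj₂ S))
    where
      columns : ∀ {k} → t k ∉ map proj₁ S → ∀ l → t′ l ∈ map proj₂ S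
      columns {k} k∉ l with □-resolving-meets-row-or-column (pendant k) (pendant′ l) resolving
      ... | z , z∈S , inj₁ eq = ⊥-elim (k∉ (subst (_∈ map proj₁ S) eq (∈-map⁺ proj₁ z∈S)))
      ... | z , z∈S , inj₂ eq = subst (_∈ map proj₂ S) eq (∈-map⁺ proj₂ z∈S)

module _ {V W : Set} {G : Graph W} (f : V ↔ W) where
  open Inverse f

  comap-walk : ∀ {a b k} → Walk G a b k → Walk (comap to G) (from a) (from b) k
  comap-walk here = here
  comap-walk (step e p) =
    step (subst₂ (_~_ G) (sym (strictlyInverseˡ _)) (sym (strictlyInverseˡ _)) e) (comap-walk p)

  comap-isDistance : ∀ {d} → IsDistance G d → IsDistance (comap to G) (λ u v → d (to u) (to v))
  comap-isDistance {d} G-dist = record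
    { walk      = λ u v → subst₂ (λ a b → Walk _ a b (d (to u) (to v)))
                            (strictlyInverseʳ u) (strictlyInverseʳ v) (comap-walk (walk (to u) (to v)))
    ; diagonal  = λ v → diagonal (to v)
    ; lipschitz = λ v → lipschitz (to v)
    }
    where open IsDistance G-dist

module _ {V W : Set} {G : Graph V} {H : Graph W} {d : V → V → ℕ} {e : W → W → ℕ}
         (G-dist : IsDistance G d) (H-dist : IsDistance H e) (f : V ↔ W)
         (isometry : ∀ u v → d u v ≡ e (Inverse.to f u) (Inverse.to f v)) where
  open Inverse f
  private
    module G = IsDistance G-dist
    module H = IsDistance H-dist

    d-from : ∀ v y → d v (from y) ≡ e (to v) y
    d-from v y = trans (isometry v (from y)) (cong (e (to v)) (strictlyInverseˡ y))

    to-≢ : ∀ {u v} → u ≢ v → to u ≢ to v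
    to-≢ u≢v = u≢v ∘ Injection.injective (↔⇒↣ f)

  resolving-transport : ∀ {S} → Resolving H S → Resolving G (map from S)
  resolving-transport H-resolving v w v≢w =
    let y , y∈S , y-resolves = H-resolving (to v) (to w) (to-≢ v≢w)
    in from y , ∈-map⁺ from y∈S ,
       G.≢⇒resolves (λ eq → H.resolves⇒≢ y-resolves (trans (sym (d-from v y)) (trans eq (d-from w y))))

  doublyResolving-transport : ∀ {S} → DoublyResolving H S → DoublyResolving G (map from S)
  doublyResolving-transport H-resolving v w v≢w =
    let y , y′ , y∈S , y′∈S , resolves = H-resolving (to v) (to w) (to-≢ v≢w)
    in from y , from y′ , ∈-map⁺ from y∈S , ∈-map⁺ from y′∈S ,
       G.doublyResolvesᵈ⇒doublyResolves (λ eq → H.doublyResolves⇒doublyResolvesᵈ resolves (begin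
         e (to v) y + e (to w) y′      ≡⟨ cong₂ _+_ (d-from v y) (d-from w y′) ⟨
         d v (from y) + d w (from y′)  ≡⟨ eq ⟩
         d v (from y′) + d w (from y)  ≡⟨ cong₂ _+_ (d-from v y′) (d-from w y) ⟩
         e (to v) y′ + e (to w) y      ∎))

module _ {V W : Set} {G : Graph V} {H : Graph W} {d : V → V → ℕ} {e : W → W → ℕ}
         (G-dist : IsDistance G d) (H-dist : IsDistance H e) (f : V ↔ W)
         (isometry : ∀ u v → d u v ≡ e (Inverse.to f u) (Inverse.to f v)) where
  open Inverse f
  private
    isometry⁻¹ : ∀ a b → e a b ≡ d (from a) (from b)
    isometry⁻¹ a b =
      sym (trans (isometry (from a) (from b)) (cong₂ e (strictlyInverseˡ a) (strictlyInverseˡ b)))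

  metricDim-transport : ∀ {m} → MetricDim H m → MetricDim G m
  metricDim-transport ((S , unique , resolving , length≡m) , minimal) =
    ( map from S
    , unique-map⁺ (Injection.injective (↔⇒↣ (↔-sym f))) unique
    , resolving-transport G-dist H-dist f isometry resolving
    , trans (length-map from S) length≡m )
    , λ S′ unique′ resolving′ → ≤-trans
        (minimal (map to S′) (unique-map⁺ (Injection.injective (↔⇒↣ f)) unique′)
                 (resolving-transport H-dist G-dist (↔-sym f) isometry⁻¹ resolving′))
        (≤-reflexive (length-map to S′))

  doublyMetricDim-transport : ∀ {m} → DoublyMetricDim H m → DoublyMetricDim G m
  doublyMetricDim-transport ((S , unique , resolving , length≡m) , minimal) =
    ( map from S
    , unique-map⁺ (Injection.injective (↔⇒↣ (↔-sym f))) unique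
    , doublyResolving-transport G-dist H-dist f isometry resolving
    , trans (length-map from S) length≡m )
    , λ S′ unique′ resolving′ → ≤-trans
        (minimal (map to S′) (unique-map⁺ (Injection.injective (↔⇒↣ f)) unique′)
                 (doublyResolving-transport H-dist G-dist (↔-sym f) isometry⁻¹ resolving′))
        (≤-reflexive (length-map to S′))

pattern spine i = inj₁ i
pattern tooth i = inj₂ i

module Comb (L : ℕ) where

  Position : Set
  Position = Fin (suc L)

  Vertex : Set
  Vertex = Position ⊎ Position

  gap : Position → Position → ℕ
  gap i k = ∣ toℕ i - toℕ k ∣

  data Edge : Vertex → Vertex → Set where
    right : ∀ {i k} → toℕ k ≡ suc (toℕ i) → Edge (spine i) (spine k)
    left  : ∀ {i k} → toℕ i ≡ suc (toℕ k) → Edge (spine i) (spine k)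
    up    : ∀ {i} → Edge (spine i) (tooth i)
    down  : ∀ {i} → Edge (tooth i) (spine i)

  comb : Graph Vertex
  comb = record { _~_ = Edge ; ~-sym = sym-edge ; ~-irr = irr-edge }
    where
      sym-edge : ∀ {u v} → Edge u v → Edge v u
      sym-edge (right eq) = left eq
      sym-edge (left eq)  = right eq
      sym-edge up         = down
      sym-edge down       = up

      irr-edge : ∀ {v} → ¬ Edge v v
      irr-edge (right eq) = 1+n≰n (≤-reflexive (sym eq))
      irr-edge (left eq)  = 1+n≰n (≤-reflexive (sym eq))

  height : Vertex → ℕ
  height (spine _) = 0
  height (tooth _) = 1

  column : Vertex → Position
  column (spine i) = i
  column (tooth i) = i

  d : Vertex → Vertex → ℕ
  d (spine i) (spine k) = gap i k
  d (spine i) (tooth k) = suc (gap i k)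
  d (tooth i) (spine k) = suc (gap i k)
  d (tooth i) (tooth k) = if does (i ≟ k) then 0 else 2 + gap i k

  d-diagonal : ∀ v → d v v ≡ 0
  d-diagonal (spine i) = ∣n-n∣≡0 (toℕ i)
  d-diagonal (tooth i) rewrite dec-true (i ≟ i) refl = refl

  d-tooth-tooth-≢ : ∀ {i k} → i ≢ k → d (tooth i) (tooth k) ≡ 2 + gap i k
  d-tooth-tooth-≢ {i} {k} i≢k rewrite dec-false (i ≟ k) i≢k = refl

  gap≤d-tooth-tooth : ∀ i k → gap i k ≤ d (tooth i) (tooth k)
  gap≤d-tooth-tooth i k with i ≟ k
  ... | yes refl = ≤-reflexive (∣n-n∣≡0 (toℕ i))
  ... | no _     = m≤n+m (gap i k) 2

  d-tooth-tooth≤ : ∀ i k → d (tooth i) (tooth k) ≤ 2 + gap i k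
  d-tooth-tooth≤ i k with i ≟ k
  ... | yes _ = z≤n
  ... | no _  = ≤-refl

  d-tooth : ∀ u k → u ≢ tooth k → d u (tooth k) ≡ suc (height u + gap (column u) k)
  d-tooth (spine i) k _    = refl
  d-tooth (tooth i) k u≢tk = d-tooth-tooth-≢ (λ i≡k → u≢tk (cong tooth i≡k))

  tooth-pendant : ∀ k → Pendant d (tooth k) (spine k)
  tooth-pendant k = (λ ()) , λ
    { (spine j) _   → refl
    ; (tooth j) j≢k → d-tooth-tooth-≢ (λ k≡j → j≢k (cong tooth (sym k≡j))) }

  ascend : ∀ g i k → toℕ k ≡ g + toℕ i → Walk comb (spine i) (spine k) g
  ascend zero    i k eq = subst (λ k → Walk comb (spine i) (spine k) 0) (toℕ-injective (sym eq)) here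
  ascend (suc g) i k eq = step (right (toℕ-fromℕ< i+1<)) (ascend g (fromℕ< i+1<) k eq′)
    where
      i+1< : suc (toℕ i) < suc L
      i+1< = ≤-<-trans (≤-trans (s≤s (m≤n+m (toℕ i) g)) (≤-reflexive (sym eq))) (toℕ<n k)
      eq′ : toℕ k ≡ g + toℕ (fromℕ< i+1<)
      eq′ = trans eq (trans (sym (+-suc g (toℕ i))) (cong (g +_) (sym (toℕ-fromℕ< i+1<))))

  spine-walk : ∀ i k → Walk comb (spine i) (spine k) (gap i k)
  spine-walk i k with ≤-total (toℕ i) (toℕ k)
  ... | inj₁ i≤k = subst (Walk comb _ _) (sym (m≤n⇒∣m-n∣≡n∸m i≤k))
                     (ascend _ i k (sym (m∸n+n≡m i≤k)))
  ... | inj₂ k≤i = subst (Walk comb _ _) (sym (m≤n⇒∣n-m∣≡n∸m k≤i))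
                     (reverseʷ (ascend _ k i (sym (m∸n+n≡m k≤i))))

  comb-walk : ∀ u v → Walk comb u v (d u v)
  comb-walk (spine i) (spine k) = spine-walk i k
  comb-walk (spine i) (tooth k) = spine-walk i k ∷ʳ up
  comb-walk (tooth i) (spine k) = step down (spine-walk i k)
  comb-walk (tooth i) (tooth k) with i ≟ k
  ... | yes refl = here
  ... | no _     = step down (spine-walk i k ∷ʳ up)

  gap-edge : ∀ {i k} → Edge (spine i) (spine k) → gap i k ≡ 1
  gap-edge {i} {k} (right eq) = trans (cong (∣ toℕ i -_∣) eq) (∣n-1+n∣≡1 (toℕ i))
  gap-edge {i} {k} (left eq)  =
    trans (cong (∣_- toℕ k ∣) eq) (trans (∣-∣-comm (suc (toℕ k)) (toℕ k)) (∣n-1+n∣≡1 (toℕ k)))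

  gap-lipschitz : ∀ {i i′} k → Edge (spine i) (spine i′) → gap i k ≤ suc (gap i′ k)
  gap-lipschitz {i} {i′} k e =
    ≤-trans (∣-∣-triangle (toℕ i) (toℕ i′) (toℕ k)) (≤-reflexive (cong (_+ gap i′ k) (gap-edge e)))

  d-lipschitz : ∀ {u u′} v → Edge u u′ → d u v ≤ suc (d u′ v)
  d-lipschitz (spine k) e@(right _)    = gap-lipschitz k e
  d-lipschitz (spine k) e@(left _)     = gap-lipschitz k e
  d-lipschitz (tooth k) e@(right _)    = s≤s (gap-lipschitz k e)
  d-lipschitz (tooth k) e@(left _)     = s≤s (gap-lipschitz k e)
  d-lipschitz (spine _) up             = ≤-trans (n≤1+n _) (n≤1+n _)
  d-lipschitz {spine i} (tooth k) up   = s≤s (gap≤d-tooth-tooth i k)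
  d-lipschitz (spine _) down           = ≤-refl
  d-lipschitz {tooth i} (tooth k) down = d-tooth-tooth≤ i k

  comb-isDistance : IsDistance comb d
  comb-isDistance = record { walk = comb-walk ; diagonal = d-diagonal ; lipschitz = d-lipschitz }

  level : Vertex → ℕ
  level (spine i) = toℕ i
  level (tooth i) = suc (toℕ i)

  lowerNeighbour-unique : ∀ {u v w} → Edge u v → Edge u w → level v ≤ level u → level w ≤ level u → v ≡ w
  lowerNeighbour-unique (left eq)  (left eq′) _   _   =
    cong spine (toℕ-injective (suc-injective (trans (sym eq) eq′)))
  lowerNeighbour-unique down       down       _   _   = refl
  lowerNeighbour-unique (right eq) _          v≤u _   = ⊥-elim (1+n≰n (subst (_≤ _) eq v≤u))
  lowerNeighbour-unique up         _          v≤u _   = ⊥-elim (1+n≰n v≤u)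
  lowerNeighbour-unique (left _)   (right eq) _   w≤u = ⊥-elim (1+n≰n (subst (_≤ _) eq w≤u))
  lowerNeighbour-unique (left _)   up         _   w≤u = ⊥-elim (1+n≰n w≤u)

  comb-acyclic : ¬ HasCycle comb
  comb-acyclic = uniqueLowerNeighbour⇒acyclic comb level lowerNeighbour-unique

  last : Position
  last = fromℕ L

  gap-first : ∀ i → gap i zero ≡ toℕ i
  gap-first i = ∣-∣-identityʳ (toℕ i)

  gap-last : ∀ i → gap i last ≡ L ∸ toℕ i
  gap-last i = trans (cong (∣ toℕ i -_∣) (toℕ-fromℕ L)) (m≤n⇒∣m-n∣≡n∸m (toℕ≤pred[n] i))

  gap-≤ : ∀ i k → gap i k ≤ L
  gap-≤ i k = ≤-trans (∣m-n∣≤m⊔n (toℕ i) (toℕ k)) (⊔-lub (toℕ≤pred[n] i) (toℕ≤pred[n] k))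

  diameter : ∀ u v → d u v ≤ 2 + L
  diameter (spine i) (spine k) = ≤-trans (gap-≤ i k) (m≤n+m L 2)
  diameter (spine i) (tooth k) = s≤s (≤-trans (gap-≤ i k) (n≤1+n L))
  diameter (tooth i) (spine k) = s≤s (≤-trans (gap-≤ i k) (n≤1+n L))
  diameter (tooth i) (tooth k) = ≤-trans (d-tooth-tooth≤ i k) (s≤s (s≤s (gap-≤ i k)))

  closer-to-first⇒¬closer-to-last : ∀ i k → gap i zero ≡ suc (gap k zero) → gap i last ≢ suc (gap k last)
  closer-to-first⇒¬closer-to-last i k first last
    rewrite gap-first i | gap-first k | gap-last i | gap-last k =
    1+n≰n (subst (_≤ L ∸ toℕ k) last (∸-monoʳ-≤ L (subst (toℕ k ≤_) (sym first) (n≤1+n (toℕ k)))))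

  spine-ends-separate : ∀ u v → d u (spine zero) ≡ d v (spine zero) → d u (spine last) ≡ d v (spine last) →
                        u ≡ v
  spine-ends-separate (spine i) (spine k) first _ =
    cong spine (toℕ-injective (trans (sym (gap-first i)) (trans first (gap-first k))))
  spine-ends-separate (tooth i) (tooth k) first _ =
    cong tooth (toℕ-injective (trans (sym (gap-first i)) (trans (suc-injective first) (gap-first k))))
  spine-ends-separate (spine i) (tooth k) first last =
    ⊥-elim (closer-to-first⇒¬closer-to-last i k first last)
  spine-ends-separate (tooth i) (spine k) first last =
    ⊥-elim (closer-to-first⇒¬closer-to-last k i (sym first) (sym last))

  d-own-tooth : ∀ u → d u (tooth (column u)) ≤ 1
  d-own-tooth (spine i) = ≤-reflexive (cong suc (∣n-n∣≡0 (toℕ i)))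
  d-own-tooth (tooth i) = ≤-trans (≤-reflexive (d-diagonal (tooth i))) z≤n

  d-other-tooth : ∀ u k → column u ≢ k → 2 ≤ d u (tooth k)
  d-other-tooth u k u≢k rewrite d-tooth u k (λ { refl → u≢k refl }) =
    s≤s (≤-trans (n≢0⇒n>0 (u≢k ∘ toℕ-injective ∘ ∣m-n∣≡0⇒m≡n)) (m≤n+m _ (height u)))

  columns-separate : ∀ u v → column u ≢ column v →
                     DoublyResolvesᵈ d (tooth (column u)) (tooth (column v)) u v
  columns-separate u v u≢v = <⇒≢ (≤-trans (s≤s (+-mono-≤ (d-own-tooth u) (d-own-tooth v)))
    (≤-trans (n≤1+n 3) (+-mono-≤ (d-other-tooth u _ u≢v) (d-other-tooth v _ (u≢v ∘ sym)))))

  column-separates : ∀ i o → o ≢ i → DoublyResolvesᵈ d (tooth i) (tooth o) (spine i) (tooth i)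
  column-separates i o o≢i eq = m≢1+n+m (suc (gap i o)) {1} (begin
    suc (gap i o)                                  ≡⟨ +-identityʳ _ ⟨
    suc (gap i o) + 0                              ≡⟨ cong (suc (gap i o) +_) (d-diagonal (tooth i)) ⟨
    d (spine i) (tooth o) + d (tooth i) (tooth i)  ≡⟨ eq ⟨
    d (spine i) (tooth i) + d (tooth i) (tooth o)  ≡⟨ cong₂ _+_ (cong suc (∣n-n∣≡0 (toℕ i)))
                                                                   (d-tooth-tooth-≢ (o≢i ∘ sym)) ⟩
    3 + gap i o                                    ∎)

  same-column-separates : ∀ {u v} o → u ≢ v → column u ≡ column v → o ≢ column u →
                          DoublyResolvesᵈ d (tooth (column u)) (tooth o) u v
  same-column-separates {spine i} {spine .i} _ u≢v refl _   = ⊥-elim (u≢v refl)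
  same-column-separates {tooth i} {tooth .i} _ u≢v refl _   = ⊥-elim (u≢v refl)
  same-column-separates {spine i} {tooth .i} o _   refl o≢i = column-separates i o o≢i
  same-column-separates {tooth i} {spine .i} o _   refl o≢i =
    doublyResolvesᵈ-swap {d = d} {tooth i} {tooth o} {spine i} {tooth i} (column-separates i o o≢i)

  shift-up : ∀ i g → toℕ i + g ≤ L → Σ Position λ j → gap j i ≡ g
  shift-up i g fits = fromℕ< (s≤s fits) , (begin
    gap (fromℕ< (s≤s fits)) i  ≡⟨ cong (∣_- toℕ i ∣) (toℕ-fromℕ< (s≤s fits)) ⟩
    ∣ toℕ i + g - toℕ i ∣      ≡⟨ ∣-∣-comm (toℕ i + g) (toℕ i) ⟩
    ∣ toℕ i - toℕ i + g ∣      ≡⟨ ∣m-m+n∣≡n (toℕ i) g ⟩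
    g                          ∎)

  shift-down : ∀ i g → g ≤ toℕ i → Σ Position λ j → gap j i ≡ g
  shift-down i g g≤i = fromℕ< fits , (begin
    gap (fromℕ< fits) i            ≡⟨ cong (∣_- toℕ i ∣) (toℕ-fromℕ< fits) ⟩
    ∣ toℕ i ∸ g - toℕ i ∣          ≡⟨ cong (∣ toℕ i ∸ g -_∣) (m∸n+n≡m g≤i) ⟨
    ∣ toℕ i ∸ g - toℕ i ∸ g + g ∣  ≡⟨ ∣m-m+n∣≡n (toℕ i ∸ g) g ⟩
    g                              ∎)
    where
      fits : toℕ i ∸ g < suc L
      fits = s≤s (≤-trans (m∸n≤m (toℕ i) g) (toℕ≤pred[n] i))

module LargeComb (m : ℕ) where
  open Comb (3 + m)

  L : ℕ
  L = 3 + m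

  _≟ᵥ_ : DecidableEquality Vertex
  _≟ᵥ_ = ≡-dec _≟_ _≟_

  nearby : ∀ i → Σ Position λ a → Σ Position λ b → gap a i ≡ 1 × gap b i ≡ 2
  nearby i with toℕ i + 2 ≤? L
  ... | yes fits =
    let a , a-gap = shift-up i 1 (≤-trans (+-monoʳ-≤ (toℕ i) (n≤1+n 1)) fits)
        b , b-gap = shift-up i 2 fits
    in a , b , a-gap , b-gap
  ... | no ¬fits =
    let a , a-gap = shift-down i 1 (≤-trans (n≤1+n 1) 2≤i)
        b , b-gap = shift-down i 2 2≤i
    in a , b , a-gap , b-gap
    where
      2≤i : 2 ≤ toℕ i
      2≤i = +-cancelʳ-≤ 2 2 (toℕ i) (≤-trans (s≤s (s≤s (s≤s (s≤s z≤n)))) (≰⇒> ¬fits))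

  equidistant-pair : ∀ x → Σ Vertex λ v → Σ Vertex λ w → v ≢ w × d v x ≡ d w x
  equidistant-pair x with nearby (column x)
  ... | a , b , a-gap , b-gap = tooth a , spine b , (λ ()) , equidistant x a-gap b-gap
    where
      equidistant : ∀ x → gap a (column x) ≡ 1 → gap b (column x) ≡ 2 → d (tooth a) x ≡ d (spine b) x
      equidistant (spine i) a-gap b-gap = trans (cong suc a-gap) (sym b-gap)
      equidistant (tooth i) a-gap b-gap =
        trans (d-tooth-tooth-≢ {a} {i} (λ { refl → 0≢1+n (trans (sym (∣n-n∣≡0 (toℕ a))) a-gap) }))
              (trans (cong (2 +_) a-gap) (sym (cong suc b-gap)))

  comb-metricDim : MetricDim comb 2
  comb-metricDim =
    ( spine zero ∷ spine last ∷ []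
    , ((λ ()) ∷ []) ∷ [] ∷ []
    , resolvingᵈ⇒resolving (λ u v equidistant →
        spine-ends-separate u v (equidistant _ (here refl)) (equidistant _ (there (here refl))))
    , refl )
    , λ _ _ → noResolvingVertex⇒2≤length (spine zero) equidistant-pair
    where open IsDistance comb-isDistance using (resolvingᵈ⇒resolving; noResolvingVertex⇒2≤length)

  anchor : Position → Vertex
  anchor k = if does (k ≟ zero) ∨ does (k ≟ last) then spine last else spine zero

  anchor-last : anchor last ≡ spine last
  anchor-last rewrite dec-true (last ≟ last) refl = refl

  -- In the refl cases the with-abstraction has already evaluated anchor k in the goal.
  partner : ∀ k → Σ Position λ o → o ≢ k × anchor o ≡ anchor k
  partner k with k ≟ zero
  ... | yes refl = last , (λ ()) , anchor-last
  ... | no _ with k ≟ last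
  ...   | yes refl = zero , (λ ()) , refl
  ...   | no _ with k ≟ suc zero
  ...     | yes refl = suc (suc zero) , (λ ()) , refl
  ...     | no k≢1   = suc zero , k≢1 ∘ sym , refl

  teeth-doublyResolve : DoublyResolvingᵈ d (tabulate tooth)
  teeth-doublyResolve u v u≢v with column u ≟ column v
  ... | no cu≢cv =
    tooth (column u) , tooth (column v) ,
    ∈-tabulate⁺ {f = tooth} (column u) , ∈-tabulate⁺ {f = tooth} (column v) ,
    columns-separate u v cu≢cv
  ... | yes cu≡cv with partner (column u)
  ...   | o , o≢cu , _ =
    tooth (column u) , tooth o , ∈-tabulate⁺ {f = tooth} (column u) , ∈-tabulate⁺ {f = tooth} o ,
    same-column-separates o u≢v cu≡cv o≢cu

  comb-doublyMetricDim : DoublyMetricDim comb (4 + m)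
  comb-doublyMetricDim =
    ( tabulate tooth , tabulate⁺ inj₂-injective , doublyResolvingᵈ⇒doublyResolving teeth-doublyResolve
    , length-tabulate tooth )
    , λ _ _ → pendants≤doublyResolving _≟ᵥ_ tooth spine inj₂-injective tooth-pendant
    where
      open IsDistance comb-isDistance using (doublyResolvingᵈ⇒doublyResolving; pendants≤doublyResolving)

  Balanced : Vertex → Vertex → Set
  Balanced u v = d u (tooth zero) + d v (tooth last) ≡ d u (tooth last) + d v (tooth zero)

  balanced-sym : ∀ u v → Balanced u v → Balanced v u
  balanced-sym u v eq = begin
    d v (tooth zero) + d u (tooth last)  ≡⟨ +-comm (d v (tooth zero)) _ ⟩
    d u (tooth last) + d v (tooth zero)  ≡⟨ eq ⟨
    d u (tooth zero) + d v (tooth last)  ≡⟨ +-comm (d u (tooth zero)) _ ⟩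
    d v (tooth last) + d u (tooth zero)  ∎

  data EndView : Vertex → Set where
    first-tooth : EndView (tooth zero)
    last-tooth  : EndView (tooth last)
    inner       : ∀ {u} → u ≢ tooth zero → u ≢ tooth last → EndView u

  endView : ∀ u → EndView u
  endView (spine i) = inner (λ ()) (λ ())
  endView (tooth i) with i ≟ zero | i ≟ last
  ... | yes refl | _        = first-tooth
  ... | no _     | yes refl = last-tooth
  ... | no i≢0   | no i≢L   = inner (i≢0 ∘ inj₂-injective) (i≢L ∘ inj₂-injective)

  d-first-last : d (tooth zero) (tooth last) ≡ 2 + L
  d-first-last = cong (2 +_) (toℕ-fromℕ L)

  d-last-first : d (tooth last) (tooth zero) ≡ 2 + L
  d-last-first = cong (2 +_) (toℕ-fromℕ L)

  d-first-tooth : ∀ u → u ≢ tooth zero → d u (tooth zero) ≡ suc (height u + toℕ (column u))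
  d-first-tooth u u≢0 = trans (d-tooth u zero u≢0) (cong (λ g → suc (height u + g)) (gap-first (column u)))

  d-last-tooth : ∀ u → u ≢ tooth last → d u (tooth last) ≡ suc (height u + (L ∸ toℕ (column u)))
  d-last-tooth u u≢L = trans (d-tooth u last u≢L) (cong (λ g → suc (height u + g)) (gap-last (column u)))

  ¬balanced-first-last : ¬ Balanced (tooth zero) (tooth last)
  ¬balanced-first-last eq = 0≢1+n (trans (sym (d-diagonal (tooth last))) eq)

  ¬balanced-first-inner : ∀ {v} → v ≢ tooth zero → ¬ Balanced (tooth zero) v
  ¬balanced-first-inner {v} v≢0 eq =
    m≤n⇒m≢n+1+o (≤-trans (diameter v (tooth last)) (≤-reflexive (sym d-first-last)))
      (trans eq (cong (d (tooth zero) (tooth last) +_) (d-tooth v zero v≢0)))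

  ¬balanced-last-inner : ∀ {v} → v ≢ tooth last → ¬ Balanced (tooth last) v
  ¬balanced-last-inner {v} v≢L eq =
    m≤n⇒m≢n+1+o (≤-trans (diameter v (tooth zero)) (≤-reflexive (sym d-last-first))) (begin
      d v (tooth zero)                                ≡⟨ cong (_+ d v (tooth zero)) (d-diagonal (tooth last)) ⟨
      d (tooth last) (tooth last) + d v (tooth zero)  ≡⟨ eq ⟨
      d (tooth last) (tooth zero) + d v (tooth last)  ≡⟨ cong (d (tooth last) (tooth zero) +_)
                                                              (d-tooth v last v≢L) ⟩
      d (tooth last) (tooth zero) + suc _             ∎)

  balanced-inner : ∀ {u v} → u ≢ tooth zero → u ≢ tooth last → v ≢ tooth zero → v ≢ tooth last →
                   Balanced u v → column u ≡ column v
  balanced-inner {u} {v} u≢0 u≢L v≢0 v≢L eq =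
    toℕ-injective (m+[o∸n]≡n+[o∸m]⇒m≡n L (+-cancelˡ-≡ (2 + (height u + height v)) _ _ (begin
      2 + (height u + height v) + (toℕ (column u) + (L ∸ toℕ (column v)))
        ≡⟨ regroup (height u) (height v) _ _ ⟩
      suc (height u + toℕ (column u)) + suc (height v + (L ∸ toℕ (column v)))
        ≡⟨ cong₂ _+_ (d-first-tooth u u≢0) (d-last-tooth v v≢L) ⟨
      d u (tooth zero) + d v (tooth last)
        ≡⟨ eq ⟩
      d u (tooth last) + d v (tooth zero)
        ≡⟨ cong₂ _+_ (d-last-tooth u u≢L) (d-first-tooth v v≢0) ⟩
      suc (height u + (L ∸ toℕ (column u))) + suc (height v + toℕ (column v))
        ≡⟨ regroup (height u) (height v) _ _ ⟨
      2 + (height u + height v) + ((L ∸ toℕ (column u)) + toℕ (column v))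
        ≡⟨ cong (2 + (height u + height v) +_) (+-comm (L ∸ toℕ (column u)) _) ⟩
      2 + (height u + height v) + (toℕ (column v) + (L ∸ toℕ (column u)))  ∎)))
    where
      regroup : ∀ h h′ a b → 2 + (h + h′) + (a + b) ≡ suc (h + a) + suc (h′ + b)
      regroup = ℕ-solve-∀

  balanced⇒same-column : ∀ u v → Balanced u v → column u ≡ column v
  balanced⇒same-column u v eq with endView u | endView v
  ... | first-tooth   | first-tooth   = refl
  ... | last-tooth    | last-tooth    = refl
  ... | first-tooth   | last-tooth    = ⊥-elim (¬balanced-first-last eq)
  ... | last-tooth    | first-tooth   = ⊥-elim (¬balanced-first-last (balanced-sym (tooth last) (tooth zero) eq))
  ... | first-tooth   | inner v≢0 _   = ⊥-elim (¬balanced-first-inner v≢0 eq)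
  ... | inner u≢0 _   | first-tooth   = ⊥-elim (¬balanced-first-inner u≢0 (balanced-sym u (tooth zero) eq))
  ... | last-tooth    | inner _ v≢L   = ⊥-elim (¬balanced-last-inner v≢L eq)
  ... | inner _ u≢L   | last-tooth    = ⊥-elim (¬balanced-last-inner u≢L (balanced-sym u (tooth last) eq))
  ... | inner u≢0 u≢L | inner v≢0 v≢L = balanced-inner u≢0 u≢L v≢0 v≢L eq

  landmark : Position → Vertex × Vertex
  landmark k = tooth k , anchor k

  -- Landmarks with a common anchor cancel the second coordinate: T₀ and T_L then force equal
  -- columns, and a column is split by its own tooth together with the tooth of its partner.
  landmarks-separate : ∀ u v → (∀ k → (d ⊞ d) u (landmark k) ≡ (d ⊞ d) v (landmark k)) → u ≡ v
  landmarks-separate (p , p′) (q , q′) equidistant with p ≟ᵥ q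
  ... | yes refl = cong (p ,_) (spine-ends-separate p′ q′
        (+-cancelˡ-≡ (d p (tooth (suc zero))) _ _ (equidistant (suc zero)))
        (+-cancelˡ-≡ (d p (tooth zero)) _ _ (equidistant zero)))
  ... | no p≢q with partner (column p)
  ...   | o , o≢i , same-anchor = ⊥-elim (same-column-separates o p≢q same-column o≢i
          (⊞-equidistant-cancel {d = d} {d} {p , p′} {q , q′} {tooth (column p)} {tooth o} {anchor (column p)}
            (equidistant (column p)) (subst (equidistant-at o) same-anchor (equidistant o))))
    where
      equidistant-at : Position → Vertex → Set
      equidistant-at k y = (d ⊞ d) (p , p′) (tooth k , y) ≡ (d ⊞ d) (q , q′) (tooth k , y)
      same-column : column p ≡ column q
      same-column = balanced⇒same-column p q
        (⊞-equidistant-cancel {d = d} {d} {p , p′} {q , q′} {tooth zero} {tooth last} {spine last}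
          (equidistant zero) (subst (equidistant-at last) anchor-last (equidistant last)))

  comb□comb-metricDim : MetricDim (comb □ comb) (4 + m)
  comb□comb-metricDim =
    ( tabulate landmark , tabulate⁺ {f = landmark} (inj₂-injective ∘ cong proj₁)
    , resolvingᵈ⇒resolving (λ u v equidistant →
        landmarks-separate u v (λ k → equidistant _ (∈-tabulate⁺ {f = landmark} k)))
    , length-tabulate landmark )
    , λ _ _ → pendants≤□-resolving comb-isDistance comb-isDistance _≟ᵥ_ _≟ᵥ_
                tooth spine tooth spine inj₂-injective inj₂-injective tooth-pendant tooth-pendant
    where open IsDistance (□-isDistance comb-isDistance comb-isDistance) using (resolvingᵈ⇒resolving)

theorem9p3 : (n : ℕ) → 4 ≤ n →
    Σ ℕ λ N → Σ (Graph (Fin N)) λ B →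
      IsTree B × MetricDim B 2 × DoublyMetricDim B n ×
      (Σ ℕ λ m → MetricDim (B □ B) m × n ≤ m × m ≤ suc n)
theorem9p3 _ (s≤s (s≤s (s≤s (s≤s (z≤n {m}))))) =
  n + n , B
  , (s≤s z≤n , connected , comap-acyclic {G = comb} to (Injection.injective (↔⇒↣ f)) comb-acyclic)
  , metricDim-transport B-dist comb-isDistance f (λ _ _ → refl) comb-metricDim
  , doublyMetricDim-transport B-dist comb-isDistance f (λ _ _ → refl) comb-doublyMetricDim
  , n
  , metricDim-transport (□-isDistance B-dist B-dist) (□-isDistance comb-isDistance comb-isDistance)
      (f ×-↔ f) (λ _ _ → refl) comb□comb-metricDim
  , ≤-refl , n≤1+n n
  where
    open Comb (3 + m)
    open LargeComb m
    n : ℕ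
    n = 4 + m
    f : Fin (n + n) ↔ Vertex
    f = +↔⊎
    open Inverse f using (to)
    B : Graph (Fin (n + n))
    B = comap to comb
    B-dist : IsDistance B (λ u v → d (to u) (to v))
    B-dist = comap-isDistance f comb-isDistance
    open IsDistance B-dist using (connected)
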